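{- Consider an instance $I$ of the following problem: $n$ jobs $J_1,\ldots,J_n$ with processing times $p_j\ge0$ and rejection penalties $e_j\ge0$, $m$ identical machines ($m$ a fixed constant), and a bound $U\ge0$; a feasible solution accepts a set $A$ and rejects the rest $R$ with $\sum_{J_j\in A}p_j\le U$, assigns each accepted job to a machine, and has cost $C_{\max}(A)+\sum_{J_j\in R}e_j$, where $C_{\max}(A)$ is the maximum machine load. Assume the optimal cost $Z^*(I)$ satisfies $\frac12\le Z^*(I)\le1$. Let $\epsilon\in(0,1)$ with $1/\epsilon$ an integer, $\Delta=\frac{\epsilon}{4m+12}$ and $\delta=\frac{\epsilon\Delta}{2}$. A job is risky if $e_j\ge\Delta$ and safe otherwise. Let $I'$ be the instance obtained from $I$ by replacing the rejection penalty $e_j$ of each risky job by the least multiple of $\delta$ that is at least $e_j$ (all other data unchanged). Then there exists a feasible solution $\pi$ for $I'$ such that (1) at most $\frac1\Delta$ risky jobs are rejected in $\pi$, and (2) the cost of $\pi$ in $I'$ is at most $(1+\frac\epsilon2)Z^*(I)$.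
   Context: $I'$ is called the restricted instance. A job is risky in $I'$ iff it is risky in $I$.
   Formalization: The processing times $p_j$, the rejection penalties $e_j$, the bound $U$ and the optimal cost $Z^*(I)$ are rational numbers. -}

module Defs where

open import Data.Nat as ℕ using (ℕ; suc)
open import Data.Integer using (ℤ; +_)
open import Data.Rational using (ℚ; _/_; 0ℚ; 1ℚ; ½; _+_; _*_; _≤_; _⊔_; ceiling)
open import Data.Fin using (Fin)
open import Data.List using (List; map; foldr; allFin; filter; length)
open import Data.Maybe using (Maybe; just; nothing)
open import Data.Fin.Properties using () renaming (_≟_ to _≟ᶠ_)
open import Data.Maybe.Properties using (≡-dec)
open import Data.Rational.Properties using (_≤?_)
open import Relation.Nullary using (Dec; yes; no; ¬_)
open import Relation.Nullary.Decidable using (⌊_⌋)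
open import Relation.Binary.PropositionalEquality using (_≡_)
open import Data.Product using (_×_)

record Instance (n : ℕ) : Set where
  field
    p : Fin n → ℚ
    e : Fin n → ℚ
    U : ℚ

open Instance public

-- A solution for n jobs on m machines: each job is either rejected
-- (nothing) or accepted and assigned to a machine (just i).
Solution : ℕ → ℕ → Set
Solution n m = Fin n → Maybe (Fin m)

Σ[_] : ∀ {k} → (Fin k → ℚ) → ℚ
Σ[ f ] = foldr _+_ 0ℚ (map f (allFin _))

-- maximum over all indices (0 for the empty index set; loads are ≥ 0)
Max[_] : ∀ {k} → (Fin k → ℚ) → ℚ
Max[ f ] = foldr _⊔_ 0ℚ (map f (allFin _))

acceptedSize : ∀ {n m} → Instance n → Solution n m → ℚ
acceptedSize {n} {m} I σ = Σ[ (λ j → if-accepted (σ j) (p I j)) ]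
  where
  if-accepted : Maybe (Fin m) → ℚ → ℚ
  if-accepted nothing  _ = 0ℚ
  if-accepted (just _) x = x

load : ∀ {n m} → Instance n → Solution n m → Fin m → ℚ
load I σ i = Σ[ (λ j → if ⌊ ≡-dec _≟ᶠ_ (σ j) (just i) ⌋ then p I j else 0ℚ) ]
  where open import Data.Bool using (if_then_else_)

Cmax : ∀ {n m} → Instance n → Solution n m → ℚ
Cmax I σ = Max[ load I σ ]

rejectionPenalty : ∀ {n m} → Instance n → Solution n m → ℚ
rejectionPenalty {n} {m} I σ = Σ[ (λ j → pen (σ j) (e I j)) ]
  where
  pen : Maybe (Fin m) → ℚ → ℚ
  pen nothing  x = x
  pen (just _) _ = 0ℚ

Feasible : ∀ {n m} → Instance n → Solution n m → Set
Feasible I σ = acceptedSize I σ ≤ U I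

cost : ∀ {n m} → Instance n → Solution n m → ℚ
cost I σ = Cmax I σ + rejectionPenalty I σ

IsOptimalCost : ∀ {n} (m : ℕ) → Instance n → ℚ → Set
IsOptimalCost {n} m I Z =
  (Σ' (Solution n m) λ σ → Feasible I σ × cost I σ ≡ Z)
  × (∀ (σ : Solution n m) → Feasible I σ → Z ≤ cost I σ)
  where open import Data.Product using () renaming (Σ to Σ')

-- Parameters: ε = 1/k (k ≥ 2 so that ε ∈ (0,1) and 1/ε = k is an integer)
ε : (k : ℕ) → .{{_ : ℕ.NonZero k}} → ℚ
ε k = + 1 / k

-- Δ = ε / (4m + 12)   (written 12 + 4m so the NonZero instance is found)
Δ : (m k : ℕ) → .{{_ : ℕ.NonZero k}} → ℚ
Δ m k = ε k * (+ 1 / (12 ℕ.+ 4 ℕ.* m))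

δ : (m k : ℕ) → .{{_ : ℕ.NonZero k}} → ℚ
δ m k = ε k * Δ m k * ½

δ⁻¹ : (m k : ℕ) → ℚ
δ⁻¹ m k = + (2 ℕ.* k ℕ.* k ℕ.* (12 ℕ.+ 4 ℕ.* m)) / 1

roundUpδ : (m k : ℕ) → .{{_ : ℕ.NonZero k}} → ℚ → ℚ
roundUpδ m k x = (ceiling (x * δ⁻¹ m k) / 1) * δ m k

Risky : (m k : ℕ) → .{{_ : ℕ.NonZero k}} → ℚ → Set
Risky m k x = Δ m k ≤ x

restricted : ∀ {n} (m k : ℕ) → .{{_ : ℕ.NonZero k}} → Instance n → Instance n
restricted m k I = record
  { p = p I
  ; e = λ j → e' (Δ m k ≤? e I j) (e I j)
  ; U = U I }
  where
  e' : ∀ {x} → Dec (Δ m k ≤ x) → ℚ → ℚ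
  e' (yes _) x = roundUpδ m k x
  e' (no _)  x = x

-- number of risky jobs rejected by σ (riskiness w.r.t. the original e)
rejectedRisky : ∀ {n m'} (m k : ℕ) → .{{_ : ℕ.NonZero k}} → Instance n → Solution n m' → ℕ
rejectedRisky m k I σ =
  length (filter (λ j → (Δ m k ≤? e I j) ×-dec (≡-dec _≟ᶠ_ (σ j) nothing)) (allFin _))
  where open import Relation.Nullary.Decidable using (_×-dec_)

Δ⁻¹ : (m k : ℕ) → ℚ
Δ⁻¹ m k = + (k ℕ.* (12 ℕ.+ 4 ℕ.* m)) / 1

-- An optimal solution of I already works. Rounding raises the penalty of a risky job by at most δ
-- and leaves safe jobs alone, so its cost in I′ exceeds Z by at most c·δ, where c is the number of
-- risky jobs it rejects. Each of those already costs at least Δ in I, so c·Δ ≤ Z ≤ 1, i.e. c ≤ 1/Δ,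
-- and c·δ = c·Δ·ε/2 ≤ Z·ε/2.
module Submission where

open import Defs
open import Data.Nat using (ℕ; suc; NonZero; _≥_)
import Data.Nat as ℕ
import Data.Nat.Properties as ℕ
open import Data.Nat.Coprimality using (Coprime)
open import Data.Nat.Tactic.RingSolver using (solve-∀)
open import Data.Integer using (+_)
import Data.Integer as ℤ
import Data.Integer.DivMod as ℤ
import Data.Integer.Properties as ℤ
import Data.Integer.Tactic.RingSolver as ℤ-Solver
open import Data.Rational
  using (ℚ; mkℚ; _/_; 0ℚ; 1ℚ; ½; _+_; _*_; _≤_; _⊔_; ceiling; toℚᵘ; NonNegative; nonNegative)
open import Data.Rational.Properties
  using ( toℚᵘ-injective; toℚᵘ-fromℚᵘ; toℚᵘ-homo-+; toℚᵘ-homo-*; toℚᵘ-cancel-≤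
        ; normalize-nonNeg; nonNegative⁻¹; nonNeg*nonNeg⇒nonNeg; *-monoʳ-≤-nonNeg
        ; ≤-refl; ≤-reflexive; ≤-trans; +-mono-≤; +-monoˡ-≤; +-monoʳ-≤; p≤q⊔p
        ; +-identityˡ; +-identityʳ; +-assoc; *-identityˡ; *-identityʳ; *-assoc; *-zeroˡ
        ; _≤?_; module ≤-Reasoning )
open import Data.Rational.Solver using (module +-*-Solver)
open import Data.Rational.Unnormalised as ℚᵘ using (mkℚᵘ; _≃_; *≡*)
import Data.Rational.Unnormalised.Properties as ℚᵘ
open import Data.Fin using (Fin)
open import Data.Fin.Properties using () renaming (_≟_ to _≟ᶠ_)
open import Data.List using (List; []; _∷_; map; foldr; filter; length; allFin)
open import Data.List.Properties using (map-cong)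
open import Data.Maybe using (Maybe; just; nothing)
open import Data.Maybe.Properties using (≡-dec)
open import Data.Product using (Σ; _×_; _,_)
open import Data.Empty using (⊥-elim)
open import Level using (0ℓ)
open import Relation.Nullary using (¬_; yes; no)
open import Relation.Nullary.Decidable using (_×-dec_)
open import Relation.Unary using (Pred; Decidable)
open import Relation.Binary.PropositionalEquality

toℚᵘ-/ : ∀ i d → toℚᵘ (i / suc d) ≃ mkℚᵘ i d
toℚᵘ-/ i d = toℚᵘ-fromℚᵘ (mkℚᵘ i d)

/1-homo-* : ∀ a b → + (a ℕ.* b) / 1 ≡ + a / 1 * (+ b / 1)
/1-homo-* a b = toℚᵘ-injective (begin
  toℚᵘ (+ (a ℕ.* b) / 1)             ≈⟨ toℚᵘ-/ (+ (a ℕ.* b)) 0 ⟩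
  mkℚᵘ (+ (a ℕ.* b)) 0               ≈⟨ *≡* (cong (ℤ._* + 1) (ℤ.pos-* a b)) ⟩
  mkℚᵘ (+ a) 0 ℚᵘ.* mkℚᵘ (+ b) 0     ≈⟨ ℚᵘ.*-cong (toℚᵘ-/ (+ a) 0) (toℚᵘ-/ (+ b) 0) ⟨
  toℚᵘ (+ a / 1) ℚᵘ.* toℚᵘ (+ b / 1) ≈⟨ toℚᵘ-homo-* (+ a / 1) (+ b / 1) ⟨
  toℚᵘ (+ a / 1 * (+ b / 1))         ∎)
  where open ℚᵘ.≃-Reasoning

/1-homo-+ : ∀ a b → + (a ℕ.+ b) / 1 ≡ + a / 1 + + b / 1
/1-homo-+ a b = toℚᵘ-injective (begin
  toℚᵘ (+ (a ℕ.+ b) / 1)             ≈⟨ toℚᵘ-/ (+ (a ℕ.+ b)) 0 ⟩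
  mkℚᵘ (+ (a ℕ.+ b)) 0               ≈⟨ *≡* (cong (ℤ._* + 1) numerators) ⟩
  mkℚᵘ (+ a) 0 ℚᵘ.+ mkℚᵘ (+ b) 0     ≈⟨ ℚᵘ.+-cong (toℚᵘ-/ (+ a) 0) (toℚᵘ-/ (+ b) 0) ⟨
  toℚᵘ (+ a / 1) ℚᵘ.+ toℚᵘ (+ b / 1) ≈⟨ toℚᵘ-homo-+ (+ a / 1) (+ b / 1) ⟨
  toℚᵘ (+ a / 1 + + b / 1)           ∎)
  where
  open ℚᵘ.≃-Reasoning
  numerators : + (a ℕ.+ b) ≡ + a ℤ.* + 1 ℤ.+ + b ℤ.* + 1
  numerators = sym (cong₂ ℤ._+_ (ℤ.*-identityʳ (+ a)) (ℤ.*-identityʳ (+ b)))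

1/n*n≡1 : ∀ n .{{_ : NonZero n}} → + 1 / n * (+ n / 1) ≡ 1ℚ
1/n*n≡1 (suc a) = toℚᵘ-injective (begin
  toℚᵘ (+ 1 / suc a * (+ suc a / 1))          ≈⟨ toℚᵘ-homo-* (+ 1 / suc a) (+ suc a / 1) ⟩
  toℚᵘ (+ 1 / suc a) ℚᵘ.* toℚᵘ (+ suc a / 1)  ≈⟨ ℚᵘ.*-cong (toℚᵘ-/ (+ 1) a) (toℚᵘ-/ (+ suc a) 0) ⟩
  mkℚᵘ (+ 1) a ℚᵘ.* mkℚᵘ (+ suc a) 0          ≈⟨ *≡* (cong (λ x → + suc x) (cross a)) ⟩
  toℚᵘ 1ℚ                                     ∎)
  where
  open ℚᵘ.≃-Reasoning
  cross : ∀ a → (a ℕ.+ 0 ℕ.* suc a) ℕ.* 1 ≡ a ℕ.* 1 ℕ.+ 0 ℕ.* suc (a ℕ.* 1)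
  cross = solve-∀

ceiling-mkℚ : ∀ n d .(c : Coprime ℤ.∣ n ∣ (suc d)) → ceiling (mkℚ n d c) ≡ ℤ.- ((ℤ.- n) ℤ./ + suc d)
ceiling-mkℚ (+ 0) d c = refl
ceiling-mkℚ ℤ.+[1+ _ ] d c = refl
ceiling-mkℚ ℤ.-[1+ _ ] d c = refl

ceiling*D≤n+D : ∀ n d .(c : Coprime ℤ.∣ n ∣ (suc d)) → ceiling (mkℚ n d c) ℤ.* + suc d ℤ.≤ n ℤ.+ + suc d
ceiling*D≤n+D n d c = begin
  ceiling (mkℚ n d c) ℤ.* D          ≡⟨ cong (ℤ._* D) (ceiling-mkℚ n d c) ⟩
  ℤ.- q ℤ.* D                       ≡⟨ shift q D ⟩
  ℤ.- ((ℤ.+ 1 ℤ.+ q) ℤ.* D) ℤ.+ D  ≤⟨ ℤ.+-monoˡ-≤ D (ℤ.neg-mono-≤ (ℤ.<⇒≤ -n<[1+q]D)) ⟩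
  ℤ.- (ℤ.- n) ℤ.+ D                 ≡⟨ cong (ℤ._+ D) (ℤ.neg-involutive n) ⟩
  n ℤ.+ D                          ∎
  where
  open ℤ.≤-Reasoning
  D = + suc d
  q = (ℤ.- n) ℤ./ D
  shift : ∀ q D → ℤ.- q ℤ.* D ≡ ℤ.- ((ℤ.+ 1 ℤ.+ q) ℤ.* D) ℤ.+ D
  shift = ℤ-Solver.solve-∀
  -n<[1+q]D : ℤ.- n ℤ.< (ℤ.+ 1 ℤ.+ q) ℤ.* D
  -n<[1+q]D rewrite ℤ.div-pos-is-/ℕ (ℤ.- n) (suc d) {{_}} = ℤ.n<s[n/ℕd]*d (ℤ.- n) (suc d)

ceiling-≤ : ∀ y → ceiling y / 1 ≤ y + 1ℚ
ceiling-≤ y@(mkℚ n d c) = toℚᵘ-cancel-≤ (begin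
  toℚᵘ (ceiling y / 1)        ≃⟨ toℚᵘ-/ (ceiling y) 0 ⟩
  mkℚᵘ (ceiling y) 0          ≤⟨ ℚᵘ.*≤* (subst₂ ℤ._≤_ denominator numerator (ceiling*D≤n+D n d c)) ⟩
  mkℚᵘ n d ℚᵘ.+ mkℚᵘ (+ 1) 0  ≃⟨ toℚᵘ-homo-+ y 1ℚ ⟨
  toℚᵘ (y + 1ℚ)               ∎)
  where
  open ℚᵘ.≤-Reasoning
  denominator : ceiling y ℤ.* + suc d ≡ ceiling y ℤ.* + suc (d ℕ.* 1)
  denominator = cong (λ b → ceiling y ℤ.* + suc b) (sym (ℕ.*-identityʳ d))
  numerator : n ℤ.+ + suc d ≡ (n ℤ.* + 1 ℤ.+ + 1 ℤ.* + suc d) ℤ.* + 1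
  numerator = sym (trans (ℤ.*-identityʳ _) (cong₂ ℤ._+_ (ℤ.*-identityʳ n) (ℤ.*-identityˡ (+ suc d))))

0≤+/ : ∀ a n .{{_ : NonZero n}} → 0ℚ ≤ + a / n
0≤+/ a n = nonNegative⁻¹ (+ a / n) {{normalize-nonNeg a n}}

0≤* : ∀ {p q} → 0ℚ ≤ p → 0ℚ ≤ q → 0ℚ ≤ p * q
0≤* {p} {q} 0≤p 0≤q =
  nonNegative⁻¹ (p * q) {{nonNeg*nonNeg⇒nonNeg p {{nonNegative 0≤p}} q {{nonNegative 0≤q}}}}

0≤foldr-⊔ : ∀ xs → 0ℚ ≤ foldr _⊔_ 0ℚ xs
0≤foldr-⊔ []       = ≤-refl
0≤foldr-⊔ (x ∷ xs) = ≤-trans (0≤foldr-⊔ xs) (p≤q⊔p x _)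

⌈x*a⌉*d≤x+d : ∀ x {a d} → 0ℚ ≤ d → d * a ≡ 1ℚ → (ceiling (x * a) / 1) * d ≤ x + d
⌈x*a⌉*d≤x+d x {a} {d} 0≤d d*a≡1 = begin
  (ceiling (x * a) / 1) * d  ≤⟨ *-monoʳ-≤-nonNeg d {{nonNegative 0≤d}} (ceiling-≤ (x * a)) ⟩
  (x * a + 1ℚ) * d           ≡⟨ expand x a d ⟩
  x * (d * a) + d            ≡⟨ cong (λ t → x * t + d) d*a≡1 ⟩
  x * 1ℚ + d                 ≡⟨ cong (_+ d) (*-identityʳ x) ⟩
  x + d                      ∎
  where
  open ≤-Reasoning
  open +-*-Solver
  expand : ∀ x a d → (x * a + 1ℚ) * d ≡ x * (d * a) + d
  expand = solve 3 (λ x a d → (x :* a :+ con 1ℚ) :* d := x :* (d :* a) :+ d) refl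

∑ : ∀ {A : Set} → (A → ℚ) → List A → ℚ
∑ f xs = foldr _+_ 0ℚ (map f xs)

count : ∀ {A : Set} {ℓ} {P : Pred A ℓ} → Decidable P → List A → ℚ
count P? xs = + length (filter P? xs) / 1

module _ {A : Set} {ℓ} {P : Pred A ℓ} (P? : Decidable P) where

  count*≤∑ : ∀ (f : A → ℚ) {D} → (∀ x → 0ℚ ≤ f x) → (∀ {x} → P x → D ≤ f x) →
             ∀ xs → count P? xs * D ≤ ∑ f xs
  count*≤∑ f {D} 0≤f D≤f [] = ≤-reflexive (*-zeroˡ D)
  count*≤∑ f {D} 0≤f D≤f (x ∷ xs) with P? x
  ... | yes px = begin
    (+ suc (length (filter P? xs)) / 1) * D  ≡⟨ cong (_* D) (/1-homo-+ 1 (length (filter P? xs))) ⟩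
    (1ℚ + count P? xs) * D                   ≡⟨ distrib (count P? xs) D ⟩
    D + count P? xs * D                      ≤⟨ +-mono-≤ (D≤f px) (count*≤∑ f 0≤f D≤f xs) ⟩
    f x + ∑ f xs                             ∎
    where
    open ≤-Reasoning
    open +-*-Solver
    distrib : ∀ c D → (1ℚ + c) * D ≡ D + c * D
    distrib = solve 2 (λ c D → (con 1ℚ :+ c) :* D := D :+ c :* D) refl
  ... | no _ = begin
    count P? xs * D  ≤⟨ count*≤∑ f 0≤f D≤f xs ⟩
    ∑ f xs           ≡⟨ +-identityˡ (∑ f xs) ⟨
    0ℚ + ∑ f xs      ≤⟨ +-monoˡ-≤ (∑ f xs) (0≤f x) ⟩
    f x + ∑ f xs     ∎
    where open ≤-Reasoning

  ∑-≤-∑+count* : ∀ (f g : A → ℚ) {d} → (∀ {x} → P x → g x ≤ f x + d) → (∀ {x} → ¬ P x → g x ≤ f x) →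
                 ∀ xs → ∑ g xs ≤ ∑ f xs + count P? xs * d
  ∑-≤-∑+count* f g {d} g≤f+d g≤f [] = ≤-reflexive (sym (trans (+-identityˡ (0ℚ * d)) (*-zeroˡ d)))
  ∑-≤-∑+count* f g {d} g≤f+d g≤f (x ∷ xs) with P? x
  ... | yes px = begin
    g x + ∑ g xs
      ≤⟨ +-mono-≤ (g≤f+d px) (∑-≤-∑+count* f g g≤f+d g≤f xs) ⟩
    (f x + d) + (∑ f xs + count P? xs * d)
      ≡⟨ regroup (f x) (∑ f xs) (count P? xs) d ⟩
    (f x + ∑ f xs) + (1ℚ + count P? xs) * d
      ≡⟨ cong (λ c → (f x + ∑ f xs) + c * d) (/1-homo-+ 1 (length (filter P? xs))) ⟨
    (f x + ∑ f xs) + (+ suc (length (filter P? xs)) / 1) * d ∎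
    where
    open ≤-Reasoning
    open +-*-Solver
    regroup : ∀ a b c d → (a + d) + (b + c * d) ≡ (a + b) + (1ℚ + c) * d
    regroup = solve 4 (λ a b c d →
      (a :+ d) :+ (b :+ c :* d) := (a :+ b) :+ (con 1ℚ :+ c) :* d) refl
  ... | no ¬px = begin
    g x + ∑ g xs                         ≤⟨ +-mono-≤ (g≤f ¬px) (∑-≤-∑+count* f g g≤f+d g≤f xs) ⟩
    f x + (∑ f xs + count P? xs * d)     ≡⟨ +-assoc (f x) (∑ f xs) (count P? xs * d) ⟨
    (f x + ∑ f xs) + count P? xs * d     ∎
    where open ≤-Reasoning

module _ (m k : ℕ) .{{_ : NonZero k}} where

  Δ*Δ⁻¹≡1 : Δ m k * Δ⁻¹ m k ≡ 1ℚ
  Δ*Δ⁻¹≡1 = begin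
    Δ m k * Δ⁻¹ m k                                  ≡⟨ cong (Δ m k *_) (/1-homo-* k c) ⟩
    (+ 1 / k * (+ 1 / c)) * ((+ k / 1) * (+ c / 1))  ≡⟨ rearrange (+ 1 / k) (+ 1 / c) (+ k / 1) (+ c / 1) ⟩
    (+ 1 / k * (+ k / 1)) * (+ 1 / c * (+ c / 1))    ≡⟨ cong₂ _*_ (1/n*n≡1 k) (1/n*n≡1 c) ⟩
    1ℚ * 1ℚ                                          ≡⟨⟩
    1ℚ                                               ∎
    where
    open ≡-Reasoning
    open +-*-Solver
    c = 12 ℕ.+ 4 ℕ.* m
    rearrange : ∀ a b c d → (a * b) * (c * d) ≡ (a * c) * (b * d)
    rearrange = solve 4 (λ a b c d → (a :* b) :* (c :* d) := (a :* c) :* (b :* d)) refl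

  δ⁻¹≡2k*Δ⁻¹ : δ⁻¹ m k ≡ (+ 2 / 1 * (+ k / 1)) * Δ⁻¹ m k
  δ⁻¹≡2k*Δ⁻¹ = begin
    + (2 ℕ.* k ℕ.* k ℕ.* c) / 1          ≡⟨ cong (λ x → + x / 1) (ℕ.*-assoc (2 ℕ.* k) k c) ⟩
    + (2 ℕ.* k ℕ.* (k ℕ.* c)) / 1        ≡⟨ /1-homo-* (2 ℕ.* k) (k ℕ.* c) ⟩
    + (2 ℕ.* k) / 1 * Δ⁻¹ m k            ≡⟨ cong (_* Δ⁻¹ m k) (/1-homo-* 2 k) ⟩
    (+ 2 / 1 * (+ k / 1)) * Δ⁻¹ m k      ∎
    where
    open ≡-Reasoning
    c = 12 ℕ.+ 4 ℕ.* m

  δ*δ⁻¹≡1 : δ m k * δ⁻¹ m k ≡ 1ℚ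
  δ*δ⁻¹≡1 = begin
    δ m k * δ⁻¹ m k
      ≡⟨ cong (δ m k *_) δ⁻¹≡2k*Δ⁻¹ ⟩
    (ε k * Δ m k * ½) * ((+ 2 / 1 * (+ k / 1)) * Δ⁻¹ m k)
      ≡⟨ rearrange (ε k) (Δ m k) ½ (+ 2 / 1) (+ k / 1) (Δ⁻¹ m k) ⟩
    (ε k * (+ k / 1)) * (½ * (+ 2 / 1)) * (Δ m k * Δ⁻¹ m k)
      ≡⟨ cong₂ _*_ (cong₂ _*_ (1/n*n≡1 k) (1/n*n≡1 2)) Δ*Δ⁻¹≡1 ⟩
    1ℚ * 1ℚ * 1ℚ
      ≡⟨⟩
    1ℚ ∎
    where
    open ≡-Reasoning
    open +-*-Solver
    rearrange : ∀ e D h t K D⁻¹ → (e * D * h) * ((t * K) * D⁻¹) ≡ (e * K) * (h * t) * (D * D⁻¹)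
    rearrange = solve 6 (λ e D h t K D⁻¹ →
      (e :* D :* h) :* ((t :* K) :* D⁻¹) := (e :* K) :* (h :* t) :* (D :* D⁻¹)) refl

  δ≡Δ*ε/2 : δ m k ≡ Δ m k * (ε k * ½)
  δ≡Δ*ε/2 = solve 2 (λ e D → e :* D :* con ½ := D :* (e :* con ½)) refl (ε k) (Δ m k)
    where open +-*-Solver

  0≤δ : 0ℚ ≤ δ m k
  0≤δ = 0≤* (0≤* (0≤+/ 1 k) (0≤* (0≤+/ 1 k) (0≤+/ 1 (12 ℕ.+ 4 ℕ.* m)))) (0≤+/ 1 2)

  0≤Δ⁻¹ : 0ℚ ≤ Δ⁻¹ m k
  0≤Δ⁻¹ = 0≤+/ (k ℕ.* (12 ℕ.+ 4 ℕ.* m)) 1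

  roundUpδ-≤ : ∀ x → roundUpδ m k x ≤ x + δ m k
  roundUpδ-≤ x = ⌈x*a⌉*d≤x+d x 0≤δ δ*δ⁻¹≡1

penalty : ∀ {m} → Maybe (Fin m) → ℚ → ℚ
penalty nothing  x = x
penalty (just _) _ = 0ℚ

-- Defs keeps the per-job summand of rejectionPenalty local; evaluating rejectionPenalty on a one-job
-- instance exposes it (up to + 0ℚ). Agda identifies this copy with the one inside rejectionPenalty I σ
-- because the local function ignores its module parameters I and σ.
oneJobPenalty : ∀ {m} → Maybe (Fin m) → ℚ → ℚ
oneJobPenalty o x = rejectionPenalty {1} (record { p = λ _ → 0ℚ ; e = λ _ → x ; U = 0ℚ }) (λ _ → o)

oneJobPenalty-≡ : ∀ {m} (o : Maybe (Fin m)) x → oneJobPenalty o x ≡ penalty o x + 0ℚ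
oneJobPenalty-≡ nothing  x = refl
oneJobPenalty-≡ (just _) x = refl

rejectionPenalty-≡ : ∀ {n m} (I : Instance n) (σ : Solution n m) →
                     rejectionPenalty I σ ≡ ∑ (λ j → penalty (σ j) (e I j)) (allFin n)
rejectionPenalty-≡ {n} I σ = cong (foldr _+_ 0ℚ) (map-cong
  (λ j → trans (sym (+-identityʳ _)) (trans (oneJobPenalty-≡ (σ j) (e I j)) (+-identityʳ _)))
  (allFin n))

0≤penalty : ∀ {m} (o : Maybe (Fin m)) {x} → 0ℚ ≤ x → 0ℚ ≤ penalty o x
0≤penalty nothing  0≤x = 0≤x
0≤penalty (just _) _   = ≤-refl

Cmax-nonNeg : ∀ {n m} (I : Instance n) (σ : Solution n m) → 0ℚ ≤ Cmax I σ
Cmax-nonNeg {m = m} I σ = 0≤foldr-⊔ (map (load I σ) (allFin m))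

rejectionPenalty≤cost : ∀ {n m} (I : Instance n) (σ : Solution n m) → rejectionPenalty I σ ≤ cost I σ
rejectionPenalty≤cost I σ =
  ≤-trans (≤-reflexive (sym (+-identityˡ _))) (+-monoˡ-≤ (rejectionPenalty I σ) (Cmax-nonNeg I σ))

module _ {n : ℕ} (m k : ℕ) .{{_ : NonZero k}} (I : Instance n) where

  e-restricted-risky : ∀ {j} → Risky m k (e I j) → e (restricted m k I) j ≤ e I j + δ m k
  e-restricted-risky {j} risky with Δ m k ≤? e I j
  ... | yes _    = roundUpδ-≤ m k (e I j)
  ... | no ¬risky = ⊥-elim (¬risky risky)

  e-restricted-safe : ∀ {j} → ¬ Risky m k (e I j) → e (restricted m k I) j ≡ e I j
  e-restricted-safe {j} ¬risky with Δ m k ≤? e I j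
  ... | yes risky = ⊥-elim (¬risky risky)
  ... | no _      = refl

  module _ {m′ : ℕ} (σ : Solution n m′) where

    RejectedRisky : Pred (Fin n) 0ℓ
    RejectedRisky j = Risky m k (e I j) × σ j ≡ nothing

    rejectedRisky? : Decidable RejectedRisky
    rejectedRisky? j = (Δ m k ≤? e I j) ×-dec (≡-dec _≟ᶠ_ (σ j) nothing)

    #rejectedRisky : ℚ
    #rejectedRisky = + rejectedRisky m k I σ / 1

    #rejectedRisky*Δ≤rejectionPenalty : (∀ j → 0ℚ ≤ e I j) → #rejectedRisky * Δ m k ≤ rejectionPenalty I σ
    #rejectedRisky*Δ≤rejectionPenalty 0≤e =
      subst (#rejectedRisky * Δ m k ≤_) (sym (rejectionPenalty-≡ I σ))
            (count*≤∑ rejectedRisky? (λ j → penalty (σ j) (e I j)) (λ j → 0≤penalty (σ j) (0≤e j))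
                      Δ≤penalty (allFin n))
      where
      Δ≤penalty : ∀ {j} → RejectedRisky j → Δ m k ≤ penalty (σ j) (e I j)
      Δ≤penalty {j} (risky , rejected) rewrite rejected = risky

    rejectionPenalty-restricted-≤ :
      rejectionPenalty (restricted m k I) σ ≤ rejectionPenalty I σ + #rejectedRisky * δ m k
    rejectionPenalty-restricted-≤ =
      subst₂ (λ P′ P → P′ ≤ P + #rejectedRisky * δ m k)
             (sym (rejectionPenalty-≡ (restricted m k I) σ)) (sym (rejectionPenalty-≡ I σ))
             (∑-≤-∑+count* rejectedRisky? (λ j → penalty (σ j) (e I j))
                           (λ j → penalty (σ j) (e (restricted m k I) j)) risky≤ safe≤ (allFin n))
      where
      risky≤ : ∀ {j} → RejectedRisky j →
               penalty (σ j) (e (restricted m k I) j) ≤ penalty (σ j) (e I j) + δ m k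
      risky≤ (risky , rejected) rewrite rejected = e-restricted-risky risky
      safe≤ : ∀ {j} → ¬ RejectedRisky j → penalty (σ j) (e (restricted m k I) j) ≤ penalty (σ j) (e I j)
      safe≤ {j} ¬rejectedRisky with σ j
      ... | nothing = ≤-reflexive (e-restricted-safe (λ risky → ¬rejectedRisky (risky , refl)))
      ... | just _  = ≤-refl

    cost-restricted-≤ : (∀ j → 0ℚ ≤ e I j) → cost (restricted m k I) σ ≤ (1ℚ + ε k * ½) * cost I σ
    cost-restricted-≤ 0≤e = begin
      C + rejectionPenalty (restricted m k I) σ  ≤⟨ +-monoʳ-≤ C rejectionPenalty-restricted-≤ ⟩
      C + (P + c * δ m k)                        ≡⟨ cong (λ d → C + (P + c * d)) (δ≡Δ*ε/2 m k) ⟩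
      C + (P + c * (Δ m k * ε/2))                ≡⟨ regroup C P c (Δ m k) ε/2 ⟩
      cost I σ + (c * Δ m k) * ε/2               ≤⟨ +-monoʳ-≤ (cost I σ) (*-monoʳ-≤-nonNeg ε/2 c*Δ≤cost) ⟩
      cost I σ + cost I σ * ε/2                  ≡⟨ factor (cost I σ) ε/2 ⟩
      (1ℚ + ε/2) * cost I σ                      ∎
      where
      open ≤-Reasoning
      open +-*-Solver
      C = Cmax I σ
      P = rejectionPenalty I σ
      c = #rejectedRisky
      ε/2 = ε k * ½
      instance
        ε/2-nonNeg : NonNegative ε/2
        ε/2-nonNeg = nonNegative (0≤* (0≤+/ 1 k) (0≤+/ 1 2))
      c*Δ≤cost : c * Δ m k ≤ cost I σ
      c*Δ≤cost = ≤-trans (#rejectedRisky*Δ≤rejectionPenalty 0≤e) (rejectionPenalty≤cost I σ)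
      regroup : ∀ C P c D h → C + (P + c * (D * h)) ≡ (C + P) + (c * D) * h
      regroup = solve 5 (λ C P c D h →
        C :+ (P :+ c :* (D :* h)) := (C :+ P) :+ (c :* D) :* h) refl
      factor : ∀ Z h → Z + Z * h ≡ (1ℚ + h) * Z
      factor = solve 2 (λ Z h → Z :+ Z :* h := (con 1ℚ :+ h) :* Z) refl

    #rejectedRisky≤Δ⁻¹ : (∀ j → 0ℚ ≤ e I j) → cost I σ ≤ 1ℚ → #rejectedRisky ≤ Δ⁻¹ m k
    #rejectedRisky≤Δ⁻¹ 0≤e cost≤1 = begin
      c                        ≡⟨ *-identityʳ c ⟨
      c * 1ℚ                   ≡⟨ cong (c *_) (Δ*Δ⁻¹≡1 m k) ⟨
      c * (Δ m k * Δ⁻¹ m k)    ≡⟨ *-assoc c (Δ m k) (Δ⁻¹ m k) ⟨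
      (c * Δ m k) * Δ⁻¹ m k    ≤⟨ *-monoʳ-≤-nonNeg (Δ⁻¹ m k) {{nonNegative (0≤Δ⁻¹ m k)}} c*Δ≤1 ⟩
      1ℚ * Δ⁻¹ m k             ≡⟨ *-identityˡ (Δ⁻¹ m k) ⟩
      Δ⁻¹ m k                  ∎
      where
      open ≤-Reasoning
      c = #rejectedRisky
      c*Δ≤1 : c * Δ m k ≤ 1ℚ
      c*Δ≤1 = ≤-trans (#rejectedRisky*Δ≤rejectionPenalty 0≤e) (≤-trans (rejectionPenalty≤cost I σ) cost≤1)

lemma4 : ∀ {n : ℕ} (m : ℕ) → .{{_ : NonZero m}} → (k : ℕ) → .{{_ : NonZero k}} → k ≥ 2
    → (I : Instance n)
    → (∀ j → 0ℚ ≤ p I j) → (∀ j → 0ℚ ≤ e I j) → 0ℚ ≤ U I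
    → (Z : ℚ) → IsOptimalCost m I Z → ½ ≤ Z → Z ≤ 1ℚ
    → Σ (Solution n m) λ π →
        Feasible (restricted m k I) π
        × ((+ rejectedRisky m k I π / 1) ≤ + 1 / 1 * (+ (k Data.Nat.* (12 Data.Nat.+ 4 Data.Nat.* m)) / 1))
        × cost (restricted m k I) π ≤ (1ℚ + ε k * ½) * Z
lemma4 m k _ I _ 0≤e _ Z ((σ , feasible , cost≡Z) , _) _ Z≤1 = σ , feasible , few-rejected , cheap
  where
  few-rejected : + rejectedRisky m k I σ / 1 ≤ 1ℚ * Δ⁻¹ m k
  few-rejected = ≤-trans (#rejectedRisky≤Δ⁻¹ m k I σ 0≤e (subst (_≤ 1ℚ) (sym cost≡Z) Z≤1))
                         (≤-reflexive (sym (*-identityˡ (Δ⁻¹ m k))))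
  cheap : cost (restricted m k I) σ ≤ (1ℚ + ε k * ½) * Z
  cheap = subst (λ z → cost (restricted m k I) σ ≤ (1ℚ + ε k * ½) * z) cost≡Z
                (cost-restricted-≤ m k I σ 0≤e)
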